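{- Let $f(t)$ be a formal power series in $t$ with $f(0)=1$ (with coefficients in a commutative ring not involving the $x_i$). Let $\alpha_1,\dots,\alpha_n\ge1$ be integers, $m=\sum_i\alpha_i$, and for an integer $\alpha\ge 1$ and a variable $x$ let $M(\alpha,m,x)$ be the $\alpha\times m$ matrix with entries $$M(\alpha,m,x)_{i,j}:=[t^{j-i}]\frac{f(t)}{(1-tx)^i},\qquad i\in[\alpha],\ j\in[m].$$ Then $$\det\begin{pmatrix}M(\alpha_1,m,x_1)\\ \vdots\\ M(\alpha_n,m,x_n)\end{pmatrix}=\prod_{1\le i<j\le n}(x_j-x_i)^{\alpha_i\alpha_j}.$$
   Context: $[t^k]g(t)$ denotes the coefficient of $t^k$ in the formal power series $g(t)$, which is $0$ for $k<0$. The matrix in the determinant is the $m\times m$ matrix obtained by stacking the blocks vertically; $x_1,\dots,x_n$ are indeterminates. -}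

module Defs where

open import Level using (Level)
open import Algebra.Bundles using (CommutativeRing)
open import Data.Nat as ℕ using (ℕ; zero; suc; _≤?_)
open import Data.Fin using (Fin; zero; suc; toℕ; punchIn)
open import Data.Fin using () renaming (_<?_ to _<ᶠ?_)
open import Data.Vec using (Vec; []; _++_; lookup; tabulate)
open import Relation.Nullary using (yes; no)

sumℕ : (n : ℕ) → (Fin n → ℕ) → ℕ
sumℕ zero    α = 0
sumℕ (suc n) α = α zero ℕ.+ sumℕ n (λ b → α (suc b))

stack : ∀ {a} {A : Set a} (n : ℕ) (α : Fin n → ℕ) →
        ((b : Fin n) → Vec A (α b)) → Vec A (sumℕ n α)
stack zero    α rows = []
stack (suc n) α rows = rows zero ++ stack n (λ b → α (suc b)) (λ b → rows (suc b))

module _ {c ℓ : Level} (R : CommutativeRing c ℓ) where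
  open CommutativeRing R using (Carrier; _+_; _*_; -_; _-_; 0#; 1#)

  pow : Carrier → ℕ → Carrier
  pow x zero    = 1#
  pow x (suc k) = pow x k * x

  sumFin : (n : ℕ) → (Fin n → Carrier) → Carrier
  sumFin zero    h = 0#
  sumFin (suc n) h = h zero + sumFin n (λ i → h (suc i))

  prodFin : (n : ℕ) → (Fin n → Carrier) → Carrier
  prodFin zero    h = 1#
  prodFin (suc n) h = h zero * prodFin n (λ i → h (suc i))

  sumUpTo : (ℕ → Carrier) → ℕ → Carrier
  sumUpTo h zero    = h zero
  sumUpTo h (suc k) = sumUpTo h k + h (suc k)

  Series : Set c
  Series = ℕ → Carrier

  oneS : Series
  oneS zero    = 1#
  oneS (suc k) = 0#

  mulS : Series → Series → Series
  mulS f g k = sumUpTo (λ l → f l * g (k ℕ.∸ l)) k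

  powS : Series → ℕ → Series
  powS g zero    = oneS
  powS g (suc i) = mulS (powS g i) g

  -- 1/(1 - t x) = sum_k x^k t^k (the inverse of 1 - t x)
  geomS : Carrier → Series
  geomS x k = pow x k

  coeffFrac : Series → ℕ → Carrier → ℕ → Carrier
  coeffFrac f i x k = mulS f (powS (geomS x) i) k

  -- Entry M(α,m,x)_{i,j} = [t^{j-i}] f(t)/(1-tx)^i with 1-based i,j;
  -- here i0 = i-1, j0 = j-1 are 0-based, and the coefficient is 0 when j < i.
  entryM : Series → Carrier → ℕ → ℕ → Carrier
  entryM f x i0 j0 with i0 ≤? j0
  ... | yes _ = coeffFrac f (suc i0) x (j0 ℕ.∸ i0)
  ... | no  _ = 0#

  Mblock : Series → (α m : ℕ) → Carrier → Vec (Fin m → Carrier) α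
  Mblock f α m x = tabulate (λ i j → entryM f x (toℕ i) (toℕ j))

  blockMatrix : Series → (n : ℕ) (α : Fin n → ℕ) → (Fin n → Carrier) →
                Fin (sumℕ n α) → Fin (sumℕ n α) → Carrier
  blockMatrix f n α x r =
    lookup (stack n α (λ b → Mblock f (α b) (sumℕ n α) (x b))) r

  sgn : ℕ → Carrier
  sgn zero    = 1#
  sgn (suc k) = - sgn k

  det : (n : ℕ) → (Fin n → Fin n → Carrier) → Carrier
  det zero    A = 1#
  det (suc n) A =
    sumFin (suc n) (λ j → sgn (toℕ j) * A zero j * det n (λ r c → A (suc r) (punchIn j c)))

  vandProd : (n : ℕ) → (Fin n → ℕ) → (Fin n → Carrier) → Carrier
  vandProd n α x = prodFin n (λ j → prodFin n (λ i → factor i j))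
    where
    factor : Fin n → Fin n → Carrier
    factor i j with i <ᶠ? j
    ... | yes _ = pow (x j - x i) (α i ℕ.* α j)
    ... | no  _ = 1#

-- The rows of the block for x are the coefficient sequences of f(t)·tⁱ/(1 − x t)^(i+1), i < α.
-- Multiplying every row by a series g with g(0) = 1 adds to each column a combination of the
-- earlier ones, so the determinant does not change and f may be replaced by 1. Next multiply
-- every row by 1 − x₀ t, where x₀ is the node of the first block: the first row becomes
-- (1, 0, 0, …), and after expanding along it and dropping the first column, the other rows of the
-- first block are those of a block one row shorter, while the row tⁱ/(1 − y t)^(i+1) of another
-- block becomes (y − x₀)·tⁱ/(1 − y t)^(i+1) + t^(i−1)/(1 − y t)^i. This lower bidiagonal
-- combination of the old rows multiplies the determinant by (y − x₀)^α for a block of size α.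
-- Induction on the size of the first block and on the number of blocks gives the product.

module Submission where

open import Defs
open import Algebra.Bundles using (CommutativeRing)
open import Data.Nat using (ℕ; _≤_)
open import Data.Fin using (Fin)

open import Data.Nat as ℕ using (zero; suc)
open import Data.Fin as Fin using (zero; suc; toℕ; punchIn; inject₁)
open import Data.Product using (∃-syntax; Σ-syntax; _,_; proj₁)
open import Data.Fin.Properties
  using (suc-injective; toℕ-injective; _≟_; toℕ<n; toℕ-inject₁; toℕ-inject≤; toℕ-fromℕ<; toℕ-fromℕ)
open import Data.Vec using (Vec; []; _∷_; _++_; lookup)
open import Data.Vec.Functional using (updateAt)
open import Data.Vec.Functional.Properties using (updateAt-updates; updateAt-minimal)
open import Data.Vec.Properties using (lookup∘tabulate)
open import Relation.Nullary using (yes; no; T?)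
open import Relation.Binary.Definitions using (tri<; tri≈; tri>)
import Data.Nat.Properties as ℕ
open import Data.Empty using (⊥-elim)
open import Function using (_∘_)
open import Relation.Binary.PropositionalEquality as ≡ using (_≡_; _≢_)

swapAdjacent : ∀ {n} → Fin n → Fin (suc n) → Fin (suc n)
swapAdjacent zero    zero          = suc zero
swapAdjacent zero    (suc zero)    = zero
swapAdjacent zero    (suc (suc c)) = suc (suc c)
swapAdjacent (suc k) zero          = zero
swapAdjacent (suc k) (suc c)       = suc (swapAdjacent k c)

swapAdjacent-inject₁ : ∀ {n} (k : Fin n) → swapAdjacent k (inject₁ k) ≡ suc k
swapAdjacent-inject₁ zero    = ≡.refl
swapAdjacent-inject₁ (suc k) = ≡.cong suc (swapAdjacent-inject₁ k)

swapAdjacent-suc : ∀ {n} (k : Fin n) → swapAdjacent k (suc k) ≡ inject₁ k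
swapAdjacent-suc zero    = ≡.refl
swapAdjacent-suc (suc k) = ≡.cong suc (swapAdjacent-suc k)

swapAdjacent-fixes : ∀ {n} (k : Fin n) j → j ≢ inject₁ k → j ≢ suc k → swapAdjacent k j ≡ j
swapAdjacent-fixes zero    zero          j≢k _   = ⊥-elim (j≢k ≡.refl)
swapAdjacent-fixes zero    (suc zero)    _   j≢k = ⊥-elim (j≢k ≡.refl)
swapAdjacent-fixes zero    (suc (suc j)) _   _   = ≡.refl
swapAdjacent-fixes (suc k) zero          _   _   = ≡.refl
swapAdjacent-fixes (suc k) (suc j)       j≢k j≢k+1 =
  ≡.cong suc (swapAdjacent-fixes k j (j≢k ∘ ≡.cong suc) (j≢k+1 ∘ ≡.cong suc))

swapAdjacent-punchIn-inject₁ : ∀ {n} (k c : Fin n) →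
  swapAdjacent k (punchIn (inject₁ k) c) ≡ punchIn (suc k) c
swapAdjacent-punchIn-inject₁ zero    zero    = ≡.refl
swapAdjacent-punchIn-inject₁ zero    (suc c) = ≡.refl
swapAdjacent-punchIn-inject₁ (suc k) zero    = ≡.refl
swapAdjacent-punchIn-inject₁ (suc k) (suc c) = ≡.cong suc (swapAdjacent-punchIn-inject₁ k c)

swapAdjacent-punchIn-suc : ∀ {n} (k c : Fin n) →
  swapAdjacent k (punchIn (suc k) c) ≡ punchIn (inject₁ k) c
swapAdjacent-punchIn-suc zero    zero    = ≡.refl
swapAdjacent-punchIn-suc zero    (suc c) = ≡.refl
swapAdjacent-punchIn-suc (suc k) zero    = ≡.refl
swapAdjacent-punchIn-suc (suc k) (suc c) = ≡.cong suc (swapAdjacent-punchIn-suc k c)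

swapAdjacent-punchIn : ∀ {n} (k : Fin (suc n)) j → j ≢ inject₁ k → j ≢ suc k →
  ∃[ k′ ] (∀ c → swapAdjacent k (punchIn j c) ≡ punchIn j (swapAdjacent k′ c))
swapAdjacent-punchIn zero          zero          j≢k _ = ⊥-elim (j≢k ≡.refl)
swapAdjacent-punchIn (suc k)       zero          _   _ = k , λ c → ≡.refl
swapAdjacent-punchIn zero          (suc zero)    _ j≢k = ⊥-elim (j≢k ≡.refl)
swapAdjacent-punchIn {suc n} zero  (suc (suc j)) _   _ = zero , commute
  where
  commute : ∀ c → swapAdjacent zero (punchIn (suc (suc j)) c) ≡ punchIn (suc (suc j)) (swapAdjacent zero c)
  commute zero          = ≡.refl
  commute (suc zero)    = ≡.refl
  commute (suc (suc c)) = ≡.refl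
swapAdjacent-punchIn {suc n} (suc k) (suc j) j≢k j≢k+1
  with swapAdjacent-punchIn k j (j≢k ∘ ≡.cong suc) (j≢k+1 ∘ ≡.cong suc)
... | k′ , commute = suc k′ , λ { zero → ≡.refl ; (suc c) → ≡.cong suc (commute c) }

module _ {a} {X : Set a} where

  append : ℕ → (ℕ → X) → (ℕ → X) → ℕ → X
  append zero    h rest t       = rest t
  append (suc k) h rest zero    = h zero
  append (suc k) h rest (suc t) = append k (h ∘ suc) rest t

  -- The default fills everything below the last block; it never enters a determinant.
  stackRows : (n : ℕ) → (Fin n → ℕ) → (Fin n → ℕ → X) → X → ℕ → X
  stackRows zero    α h default _ = default
  stackRows (suc n) α h default   = append (α zero) (h zero) (stackRows n (α ∘ suc) (h ∘ suc) default)

  cons : X → (ℕ → X) → ℕ → X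
  cons x h zero    = x
  cons x h (suc t) = h t

  splice : ℕ → (ℕ → X) → (ℕ → X) → ℕ → X
  splice zero    h h′ t       = h′ t
  splice (suc k) h h′ zero    = h zero
  splice (suc k) h h′ (suc t) = splice k (h ∘ suc) (h′ ∘ suc) t

  splice-< : ∀ k (h h′ : ℕ → X) t → t ℕ.< k → splice k h h′ t ≡ h t
  splice-< (suc k) h h′ zero    _           = ≡.refl
  splice-< (suc k) h h′ (suc t) (ℕ.s≤s t<k) = splice-< k (h ∘ suc) (h′ ∘ suc) t t<k

  splice-≥ : ∀ k (h h′ : ℕ → X) t → k ℕ.≤ t → splice k h h′ t ≡ h′ t
  splice-≥ zero    h h′ t       _           = ≡.refl
  splice-≥ (suc k) h h′ (suc t) (ℕ.s≤s k≤t) = splice-≥ k (h ∘ suc) (h′ ∘ suc) t k≤t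

  append-congʳ : ∀ k (h : ℕ → X) {rest rest′ : ℕ → X} → (∀ t → rest t ≡ rest′ t) →
    ∀ t → append k h rest t ≡ append k h rest′ t
  append-congʳ zero    h e t       = e t
  append-congʳ (suc k) h e zero    = ≡.refl
  append-congʳ (suc k) h e (suc t) = append-congʳ k (h ∘ suc) e t

  lookup-++ : ∀ {k m} (xs : Vec X k) {ys : Vec X m} {h rest : ℕ → X} → (∀ i → lookup xs i ≡ h (toℕ i)) →
    (∀ r → lookup ys r ≡ rest (toℕ r)) → ∀ r → lookup (xs ++ ys) r ≡ append k h rest (toℕ r)
  lookup-++ []       xs≡h ys≡rest r       = ys≡rest r
  lookup-++ (x ∷ xs) xs≡h ys≡rest zero    = xs≡h zero
  lookup-++ (x ∷ xs) xs≡h ys≡rest (suc r) = lookup-++ xs (xs≡h ∘ suc) ys≡rest r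

  lookup-stack : ∀ n (α : Fin n → ℕ) (v : (b : Fin n) → Vec X (α b)) (h : Fin n → ℕ → X) (default : X) →
    (∀ b i → lookup (v b) i ≡ h b (toℕ i)) → ∀ r → lookup (stack n α v) r ≡ stackRows n α h default (toℕ r)
  lookup-stack (suc n) α v h default v≡h =
    lookup-++ (v zero) (v≡h zero) (lookup-stack n (α ∘ suc) (v ∘ suc) (h ∘ suc) default (v≡h ∘ suc))

module _ {a b} {X : Set a} {Y : Set b} (G : X → Y) where

  append-map : ∀ k (h rest : ℕ → X) t → G (append k h rest t) ≡ append k (G ∘ h) (G ∘ rest) t
  append-map zero    h rest t       = ≡.refl
  append-map (suc k) h rest zero    = ≡.refl
  append-map (suc k) h rest (suc t) = append-map k (h ∘ suc) rest t

  stackRows-map : ∀ n α (h : Fin n → ℕ → X) default t →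
    G (stackRows n α h default t) ≡ stackRows n α (λ b → G ∘ h b) (G default) t
  stackRows-map zero    α h default t = ≡.refl
  stackRows-map (suc n) α h default t = ≡.trans (append-map (α zero) (h zero) _ t)
    (append-congʳ (α zero) (G ∘ h zero) (stackRows-map n (α ∘ suc) (h ∘ suc) default) t)

module _ {c ℓ} (R : CommutativeRing c ℓ) where

  open CommutativeRing R hiding (zero)
  open import Algebra.Properties.Ring ring using (-‿distribˡ-*; -‿distribʳ-*; -0#≈0#; -‿involutive; -1*x≈-x)
  open import Algebra.Properties.Semiring.Sum semiring
    using (sum; sum-syntax; sum-cong-≋; sum-replicate-zero; sum-init-last; ∑-comm; ∑-distrib-+; *-distribˡ-sum)
  open import Algebra.Properties.CommutativeSemigroup *-commutativeSemigroup
    using (x∙yz≈y∙xz; interchange; xy∙z≈xz∙y)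
  open import Algebra.Properties.CommutativeSemigroup +-commutativeSemigroup
    using () renaming (x∙yz≈y∙xz to x+yz≈y+xz)
  open import Relation.Binary.Reasoning.Setoid setoid

  [-x]y≈-xy : ∀ x y → - x * y ≈ - (x * y)
  [-x]y≈-xy x y = sym (-‿distribˡ-* x y)

  [-x]yz≈-xyz : ∀ x y z → - x * y * z ≈ - (x * y * z)
  [-x]yz≈-xyz x y z = trans (*-congʳ ([-x]y≈-xy x y)) ([-x]y≈-xy (x * y) z)

  xyz≈-[-x]yz : ∀ x y z → x * y * z ≈ - (- x * y * z)
  xyz≈-[-x]yz x y z = trans (sym (-‿involutive _)) (-‿cong (sym ([-x]yz≈-xyz x y z)))

  xy[-z]≈-xyz : ∀ x y z → x * y * - z ≈ - (x * y * z)
  xy[-z]≈-xyz x y z = sym (-‿distribʳ-* (x * y) z)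

  xyz+[-x]yz≈0 : ∀ x y z → x * y * z + - x * y * z ≈ 0#
  xyz+[-x]yz≈0 x y z = trans (+-congˡ ([-x]yz≈-xyz x y z)) (-‿inverseʳ _)

  g[sp+q]≈s[gp]+gq : ∀ g s p q → g * (s * p + q) ≈ s * (g * p) + g * q
  g[sp+q]≈s[gp]+gq g s p q = trans (distribˡ g (s * p) q) (+-congʳ (x∙yz≈y∙xz g s p))

  g[sb+d]m≈s[gbm]+gdm : ∀ g s b d m → g * (s * b + d) * m ≈ s * (g * b * m) + g * d * m
  g[sb+d]m≈s[gbm]+gdm g s b d m = begin
    g * (s * b + d) * m             ≈⟨ *-congʳ (g[sp+q]≈s[gp]+gq g s b d) ⟩
    (s * (g * b) + g * d) * m       ≈⟨ distribʳ m _ _ ⟩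
    s * (g * b) * m + g * d * m     ≈⟨ +-congʳ (*-assoc s (g * b) m) ⟩
    s * (g * b * m) + g * d * m     ∎

  cofactor-exchange : ∀ s a s′ b d → - s * a * (s′ * b * d) ≈ - s′ * b * (s * a * d)
  cofactor-exchange s a s′ b d = begin
    - s * a * (s′ * b * d)     ≈⟨ [-x]yz≈-xyz s a _ ⟩
    - (s * a * (s′ * b * d))   ≈⟨ -‿cong (x∙yz≈y∙xz (s * a) (s′ * b) d) ⟩
    - (s′ * b * (s * a * d))   ≈⟨ [-x]yz≈-xyz s′ b _ ⟨
    - s′ * b * (s * a * d)     ∎

  [xe+d]+[-x]e≈d : ∀ x e d → x * e + d + - x * e ≈ d
  [xe+d]+[-x]e≈d x e d = begin
    x * e + d + - x * e         ≈⟨ +-congʳ (+-comm _ _) ⟩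
    d + x * e + - x * e         ≈⟨ +-assoc _ _ _ ⟩
    d + (x * e + - x * e)       ≈⟨ +-congˡ (trans (+-congˡ ([-x]y≈-xy x e)) (-‿inverseʳ _)) ⟩
    d + 0#                      ≈⟨ +-identityʳ d ⟩
    d                           ∎

  [ye+d]+[-x]e≈[y-x]e+d : ∀ x y e d → y * e + d + - x * e ≈ (y - x) * e + d
  [ye+d]+[-x]e≈[y-x]e+d x y e d = begin
    y * e + d + - x * e         ≈⟨ +-assoc _ _ _ ⟩
    y * e + (d + - x * e)       ≈⟨ +-congˡ (+-comm _ _) ⟩
    y * e + (- x * e + d)       ≈⟨ +-assoc _ _ _ ⟨
    y * e + - x * e + d         ≈⟨ +-congʳ (distribʳ e y (- x)) ⟨
    (y - x) * e + d             ∎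

  1a+0b≈a : ∀ a b → 1# * a + 0# * b ≈ a
  1a+0b≈a a b = trans (+-cong (*-identityˡ a) (zeroˡ b)) (+-identityʳ a)

  sumFin≡sum : ∀ n (h : Fin n → Carrier) → sumFin R n h ≡ sum h
  sumFin≡sum zero    h = ≡.refl
  sumFin≡sum (suc n) h = ≡.cong (h zero +_) (sumFin≡sum n (h ∘ suc))

  ∑-zero : ∀ {n} {h : Fin n → Carrier} → (∀ i → h i ≈ 0#) → ∑[ i < n ] h i ≈ 0#
  ∑-zero {n} h≈0 = trans (sum-cong-≋ h≈0) (sum-replicate-zero n)

  ∑-neg : ∀ {n} (h : Fin n → Carrier) → ∑[ i < n ] (- h i) ≈ - ∑[ i < n ] h i
  ∑-neg h = begin
    ∑[ i < _ ] (- h i)       ≈⟨ sum-cong-≋ (λ i → sym (-1*x≈-x (h i))) ⟩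
    ∑[ i < _ ] (- 1# * h i)  ≈⟨ *-distribˡ-sum (- 1#) h ⟨
    - 1# * ∑[ i < _ ] h i    ≈⟨ -1*x≈-x _ ⟩
    - ∑[ i < _ ] h i         ∎

  ∑-linear : ∀ {n} s (f g : Fin n → Carrier) →
    ∑[ i < n ] (s * f i + g i) ≈ s * ∑[ i < n ] f i + ∑[ i < n ] g i
  ∑-linear s f g = trans (∑-distrib-+ (λ i → s * f i) g) (+-congʳ (sym (*-distribˡ-sum s f)))

  ∑-swapAdjacent : ∀ {n} (k : Fin n) (h : Fin (suc n) → Carrier) →
    ∑[ i < suc n ] h (swapAdjacent k i) ≈ ∑[ i < suc n ] h i
  ∑-swapAdjacent zero    h = x+yz≈y+xz _ _ _
  ∑-swapAdjacent (suc k) h = +-congˡ (∑-swapAdjacent k (h ∘ suc))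

  ∑-adjacentPair : ∀ {n} (k : Fin n) (h : Fin (suc n) → Carrier) →
    (∀ j → j ≢ inject₁ k → j ≢ suc k → h j ≈ 0#) →
    ∑[ j < suc n ] h j ≈ h (inject₁ k) + h (suc k)
  ∑-adjacentPair zero h others = begin
    h zero + (h (suc zero) + ∑[ j < _ ] h (suc (suc j)))
      ≈⟨ +-congˡ (+-congˡ (∑-zero (λ j → others (suc (suc j)) (λ ()) (λ ())))) ⟩
    h zero + (h (suc zero) + 0#) ≈⟨ +-congˡ (+-identityʳ _) ⟩
    h zero + h (suc zero)        ∎
  ∑-adjacentPair (suc k) h others = begin
    h zero + ∑[ j < _ ] h (suc j)
      ≈⟨ +-cong (others zero (λ ()) (λ ())) (∑-adjacentPair k (h ∘ suc) λ j j≢k j≢k+1 →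
           others (suc j) (j≢k ∘ suc-injective) (j≢k+1 ∘ suc-injective)) ⟩
    0# + (h (suc (inject₁ k)) + h (suc (suc k))) ≈⟨ +-identityˡ _ ⟩
    h (inject₁ (suc k)) + h (suc (suc k))        ∎

  swapAdjacent-invariant : ∀ {n} (k : Fin n) (h : Fin (suc n) → Carrier) →
    h (inject₁ k) ≈ h (suc k) → ∀ j → h (swapAdjacent k j) ≈ h j
  swapAdjacent-invariant zero    h e zero          = sym e
  swapAdjacent-invariant zero    h e (suc zero)    = e
  swapAdjacent-invariant zero    h e (suc (suc j)) = refl
  swapAdjacent-invariant (suc k) h e zero          = refl
  swapAdjacent-invariant (suc k) h e (suc j)       = swapAdjacent-invariant k (h ∘ suc) e j

  -- Determinants

  Matrix : ℕ → Set c
  Matrix n = Fin n → Fin n → Carrier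

  _ᵀ : ∀ {n} → Matrix n → Matrix n
  (A ᵀ) r c = A c r

  minor : ∀ {n} → Matrix (suc n) → Fin (suc n) → Fin (suc n) → Matrix n
  minor A i j r c = A (punchIn i r) (punchIn j c)

  sign : ∀ {n} → Fin n → Carrier
  sign j = sgn R (toℕ j)

  sign-inject₁ : ∀ {n} (k : Fin n) → sign (inject₁ k) ≡ sign k
  sign-inject₁ k = ≡.cong (sgn R) (toℕ-inject₁ k)

  expansionTerm : ∀ {n} → Matrix (suc n) → Fin (suc n) → Carrier
  expansionTerm {n} A j = sign j * A zero j * det R n (minor A zero j)

  det-expandFirstRow : ∀ {n} (A : Matrix (suc n)) → det R (suc n) A ≈ ∑[ j < suc n ] expansionTerm A j
  det-expandFirstRow {n} A = reflexive (sumFin≡sum (suc n) (expansionTerm A))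

  det-cong : ∀ {n} {A B : Matrix n} → (∀ r c → A r c ≈ B r c) → det R n A ≈ det R n B
  det-cong {zero}  _   = refl
  det-cong {suc n} {A} {B} A≈B = begin
    det R (suc n) A                ≈⟨ det-expandFirstRow A ⟩
    ∑[ j < suc n ] expansionTerm A j
      ≈⟨ sum-cong-≋ (λ j → *-cong (*-congˡ {sign j} (A≈B zero j))
                                  (det-cong (λ r c → A≈B (suc r) (punchIn j c)))) ⟩
    ∑[ j < suc n ] expansionTerm B j ≈⟨ det-expandFirstRow B ⟨
    det R (suc n) B                ∎

  det-expandFirstColumn : ∀ {n} (A : Matrix (suc n)) →
    det R (suc n) A ≈ ∑[ i < suc n ] (sign i * A i zero * det R n (minor A i zero))
  det-expandFirstColumn {zero}  A = det-expandFirstRow A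
  det-expandFirstColumn {suc n} A = begin
    det R (suc (suc n)) A ≈⟨ det-expandFirstRow A ⟩
    t₀ + ∑[ j < suc n ] (- sign j * a j * det R (suc n) (minor A zero (suc j)))
      ≈⟨ +-congˡ (sum-cong-≋ λ j → *-congˡ { - sign j * a j} (det-expandFirstColumn (minor A zero (suc j)))) ⟩
    t₀ + ∑[ j < suc n ] (- sign j * a j * ∑[ i < suc n ] (sign i * b i * D i j))
      ≈⟨ +-congˡ (sum-cong-≋ λ j → *-distribˡ-sum (- sign j * a j) (λ i → sign i * b i * D i j)) ⟩
    t₀ + ∑[ j < suc n ] ∑[ i < suc n ] (- sign j * a j * (sign i * b i * D i j))
      ≈⟨ +-congˡ (∑-comm (λ j i → - sign j * a j * (sign i * b i * D i j))) ⟩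
    t₀ + ∑[ i < suc n ] ∑[ j < suc n ] (- sign j * a j * (sign i * b i * D i j))
      ≈⟨ +-congˡ (sum-cong-≋ λ i → sum-cong-≋ λ j → cofactor-exchange (sign j) (a j) (sign i) (b i) (D i j)) ⟩
    t₀ + ∑[ i < suc n ] ∑[ j < suc n ] (- sign i * b i * (sign j * a j * D i j))
      ≈⟨ +-congˡ (sum-cong-≋ λ i → *-distribˡ-sum (- sign i * b i) (λ j → sign j * a j * D i j)) ⟨
    t₀ + ∑[ i < suc n ] (- sign i * b i * ∑[ j < suc n ] (sign j * a j * D i j))
      ≈⟨ +-congˡ (sum-cong-≋ λ i → *-congˡ { - sign i * b i} (det-expandFirstRow (minor A (suc i) zero))) ⟨
    t₀ + ∑[ i < suc n ] (- sign i * b i * det R (suc n) (minor A (suc i) zero)) ∎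
    where
    t₀ = sign {suc (suc n)} zero * A zero zero * det R (suc n) (minor A zero zero)
    a b : Fin (suc n) → Carrier
    a j = A zero (suc j)
    b i = A (suc i) zero
    D : Fin (suc n) → Fin (suc n) → Carrier
    D i j = det R n (λ r c → A (suc (punchIn i r)) (suc (punchIn j c)))

  det-transpose : ∀ {n} (A : Matrix n) → det R n (A ᵀ) ≈ det R n A
  det-transpose {zero}  A = refl
  det-transpose {suc n} A = begin
    det R (suc n) (A ᵀ)                                                ≈⟨ det-expandFirstRow (A ᵀ) ⟩
    ∑[ j < suc n ] (sign j * A j zero * det R n (minor A j zero ᵀ))
      ≈⟨ sum-cong-≋ (λ j → *-congˡ {sign j * A j zero} (det-transpose (minor A j zero))) ⟩
    ∑[ j < suc n ] (sign j * A j zero * det R n (minor A j zero))    ≈⟨ det-expandFirstColumn A ⟨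
    det R (suc n) A                                                    ∎

  det-linearRow : ∀ {n} (w : Fin n) (s : Carrier) (A B C : Matrix n) →
    (∀ r → r ≢ w → ∀ c → A r c ≈ B r c) → (∀ r → r ≢ w → ∀ c → A r c ≈ C r c) →
    (∀ c → A w c ≈ s * B w c + C w c) → det R n A ≈ s * det R n B + det R n C
  det-linearRow {suc n} w s A B C A≈B A≈C Aw = begin
    det R (suc n) A                                   ≈⟨ det-expandFirstRow A ⟩
    ∑[ j < suc n ] expansionTerm A j                  ≈⟨ sum-cong-≋ (term w A≈B A≈C Aw) ⟩
    ∑[ j < suc n ] (s * expansionTerm B j + expansionTerm C j)
      ≈⟨ ∑-linear s (expansionTerm B) (expansionTerm C) ⟩
    s * ∑[ j < suc n ] expansionTerm B j + ∑[ j < suc n ] expansionTerm C j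
      ≈⟨ +-cong (*-congˡ (det-expandFirstRow B)) (det-expandFirstRow C) ⟨
    s * det R (suc n) B + det R (suc n) C             ∎
    where
    term : ∀ w → (∀ r → r ≢ w → ∀ c → A r c ≈ B r c) → (∀ r → r ≢ w → ∀ c → A r c ≈ C r c) →
           (∀ c → A w c ≈ s * B w c + C w c) →
           ∀ j → expansionTerm A j ≈ s * expansionTerm B j + expansionTerm C j
    term zero A≈B A≈C Aw j = begin
      sign j * A zero j * det R n (minor A zero j)
        ≈⟨ *-cong (*-congˡ (Aw j)) (det-cong λ r c → A≈B (suc r) (λ ()) (punchIn j c)) ⟩
      sign j * (s * B zero j + C zero j) * det R n (minor B zero j)
        ≈⟨ g[sb+d]m≈s[gbm]+gdm (sign j) s (B zero j) (C zero j) _ ⟩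
      s * expansionTerm B j + sign j * C zero j * det R n (minor B zero j)
        ≈⟨ +-congˡ (*-congˡ (det-cong λ r c →
             trans (sym (A≈B (suc r) (λ ()) (punchIn j c))) (A≈C (suc r) (λ ()) (punchIn j c)))) ⟩
      s * expansionTerm B j + expansionTerm C j ∎
    term (suc w) A≈B A≈C Aw j = begin
      sign j * A zero j * det R n (minor A zero j)
        ≈⟨ *-congˡ (det-linearRow w s (minor A zero j) (minor B zero j) (minor C zero j)
             (λ r r≢w c → A≈B (suc r) (r≢w ∘ suc-injective) (punchIn j c))
             (λ r r≢w c → A≈C (suc r) (r≢w ∘ suc-injective) (punchIn j c))
             (λ c → Aw (punchIn j c))) ⟩
      sign j * A zero j * (s * det R n (minor B zero j) + det R n (minor C zero j))
        ≈⟨ g[sp+q]≈s[gp]+gq (sign j * A zero j) s _ _ ⟩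
      s * (sign j * A zero j * det R n (minor B zero j)) + sign j * A zero j * det R n (minor C zero j)
        ≈⟨ +-cong (*-congˡ (*-congʳ (*-congˡ (A≈B zero (λ ()) j)))) (*-congʳ (*-congˡ (A≈C zero (λ ()) j))) ⟩
      s * expansionTerm B j + expansionTerm C j ∎

  det-zeroRow : ∀ {n} (w : Fin n) (A : Matrix n) → (∀ c → A w c ≈ 0#) → det R n A ≈ 0#
  det-zeroRow {suc n} w A Aw≈0 = trans (det-expandFirstRow A) (∑-zero (term w Aw≈0))
    where
    term : ∀ w → (∀ c → A w c ≈ 0#) → ∀ j → expansionTerm A j ≈ 0#
    term zero    Aw≈0 j = trans (*-congʳ (*-congˡ (Aw≈0 j))) (trans (*-congʳ (zeroʳ _)) (zeroˡ _))
    term (suc w) Aw≈0 j = trans (*-congˡ (det-zeroRow w (minor A zero j) (λ c → Aw≈0 (punchIn j c)))) (zeroʳ _)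

  det-adjacentEqualColumns : ∀ {n} (k : Fin n) (A : Matrix (suc n)) →
    (∀ r → A r (inject₁ k) ≈ A r (suc k)) → det R (suc n) A ≈ 0#
  det-adjacentEqualColumns {suc n} k A equal = begin
    det R (suc (suc n)) A                                  ≈⟨ det-expandFirstRow A ⟩
    ∑[ j < suc (suc n) ] expansionTerm A j                 ≈⟨ ∑-adjacentPair k (expansionTerm A) vanishing ⟩
    expansionTerm A (inject₁ k) + expansionTerm A (suc k)  ≈⟨ +-congʳ pair ⟩
    sign k * A zero (suc k) * det R (suc n) (minor A zero (suc k)) + expansionTerm A (suc k)
                                                           ≈⟨ xyz+[-x]yz≈0 _ _ _ ⟩
    0#                                                     ∎
    where
    invariant : ∀ r c → A r (swapAdjacent k c) ≈ A r c
    invariant r = swapAdjacent-invariant k (A r) (equal r)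
    pair : expansionTerm A (inject₁ k) ≈ sign k * A zero (suc k) * det R (suc n) (minor A zero (suc k))
    pair = *-cong (*-cong (reflexive (sign-inject₁ k)) (equal zero)) (det-cong λ r c →
      trans (sym (invariant (suc r) (punchIn (inject₁ k) c)))
            (reflexive (≡.cong (A (suc r)) (swapAdjacent-punchIn-inject₁ k c))))
    vanishing : ∀ j → j ≢ inject₁ k → j ≢ suc k → expansionTerm A j ≈ 0#
    vanishing j j≢k j≢k+1 with swapAdjacent-punchIn k j j≢k j≢k+1
    ... | k′ , commute = trans (*-congˡ (det-adjacentEqualColumns k′ (minor A zero j) λ r → begin
      A (suc r) (punchIn j (inject₁ k′))                   ≈⟨ invariant (suc r) _ ⟨
      A (suc r) (swapAdjacent k (punchIn j (inject₁ k′)))  ≡⟨ ≡.cong (A (suc r)) (commute (inject₁ k′)) ⟩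
      A (suc r) (punchIn j (swapAdjacent k′ (inject₁ k′))) ≡⟨ ≡.cong (A (suc r) ∘ punchIn j) (swapAdjacent-inject₁ k′) ⟩
      A (suc r) (punchIn j (suc k′))                       ∎)) (zeroʳ _)

  det-swapAdjacentColumns : ∀ {n} (k : Fin n) (A : Matrix (suc n)) →
    det R (suc n) (λ r c → A r (swapAdjacent k c)) ≈ - det R (suc n) A
  det-swapAdjacentColumns {suc n} k A = begin
    det R (suc (suc n)) A′                                         ≈⟨ det-expandFirstRow A′ ⟩
    ∑[ j < suc (suc n) ] expansionTerm A′ j                        ≈⟨ sum-cong-≋ swappedTerm ⟩
    ∑[ j < suc (suc n) ] (- expansionTerm A (swapAdjacent k j))    ≈⟨ ∑-neg (expansionTerm A ∘ swapAdjacent k) ⟩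
    - ∑[ j < suc (suc n) ] expansionTerm A (swapAdjacent k j)      ≈⟨ -‿cong (∑-swapAdjacent k (expansionTerm A)) ⟩
    - ∑[ j < suc (suc n) ] expansionTerm A j                       ≈⟨ -‿cong (det-expandFirstRow A) ⟨
    - det R (suc (suc n)) A                                        ∎
    where
    A′ : Matrix (suc (suc n))
    A′ r c = A r (swapAdjacent k c)
    swappedTerm : ∀ j → expansionTerm A′ j ≈ - expansionTerm A (swapAdjacent k j)
    swappedTerm j with j ≟ inject₁ k | j ≟ suc k
    ... | yes ≡.refl | _ = begin
      sign (inject₁ k) * A zero (swapAdjacent k (inject₁ k)) * det R (suc n) (minor A′ zero (inject₁ k))
        ≈⟨ *-cong (*-cong (reflexive (sign-inject₁ k)) (reflexive (≡.cong (A zero) (swapAdjacent-inject₁ k))))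
                  (det-cong λ r c → reflexive (≡.cong (A (suc r)) (swapAdjacent-punchIn-inject₁ k c))) ⟩
      sign k * A zero (suc k) * det R (suc n) (minor A zero (suc k))   ≈⟨ xyz≈-[-x]yz _ _ _ ⟩
      - expansionTerm A (suc k)                        ≡⟨ ≡.cong (-_ ∘ expansionTerm A) (swapAdjacent-inject₁ k) ⟨
      - expansionTerm A (swapAdjacent k (inject₁ k))   ∎
    ... | no _ | yes ≡.refl = begin
      - sign k * A zero (swapAdjacent k (suc k)) * det R (suc n) (minor A′ zero (suc k))
        ≈⟨ *-cong (*-congˡ (reflexive (≡.cong (A zero) (swapAdjacent-suc k))))
                  (det-cong λ r c → reflexive (≡.cong (A (suc r)) (swapAdjacent-punchIn-suc k c))) ⟩
      - sign k * A zero (inject₁ k) * det R (suc n) (minor A zero (inject₁ k))   ≈⟨ [-x]yz≈-xyz _ _ _ ⟩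
      - (sign k * A zero (inject₁ k) * det R (suc n) (minor A zero (inject₁ k)))
        ≡⟨ ≡.cong (λ s → - (s * A zero (inject₁ k) * det R (suc n) (minor A zero (inject₁ k))))
                  (sign-inject₁ k) ⟨
      - expansionTerm A (inject₁ k)                ≡⟨ ≡.cong (-_ ∘ expansionTerm A) (swapAdjacent-suc k) ⟨
      - expansionTerm A (swapAdjacent k (suc k))   ∎
    ... | no j≢k | no j≢k+1 with swapAdjacent-punchIn k j j≢k j≢k+1
    ...   | k′ , commute = begin
      sign j * A zero (swapAdjacent k j) * det R (suc n) (minor A′ zero j)
        ≈⟨ *-congˡ (det-cong λ r c → reflexive (≡.cong (A (suc r)) (commute c))) ⟩
      sign j * A zero (swapAdjacent k j) * det R (suc n) (λ r c → minor A zero j r (swapAdjacent k′ c))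
        ≈⟨ *-congˡ (det-swapAdjacentColumns k′ (minor A zero j)) ⟩
      sign j * A zero (swapAdjacent k j) * - det R (suc n) (minor A zero j)
        ≡⟨ ≡.cong (λ i → sign i * A zero (swapAdjacent k j) * - det R (suc n) (minor A zero i))
                  (swapAdjacent-fixes k j j≢k j≢k+1) ⟨
      sign (swapAdjacent k j) * A zero (swapAdjacent k j) * - det R (suc n) (minor A zero (swapAdjacent k j))
        ≈⟨ xy[-z]≈-xyz _ _ _ ⟩
      - expansionTerm A (swapAdjacent k j) ∎

  det-equalColumnsAtDistance : ∀ d {n} (A : Matrix n) (p q : Fin n) → toℕ q ≡ suc (d ℕ.+ toℕ p) →
    (∀ r → A r p ≈ A r q) → det R n A ≈ 0#
  det-equalColumnsAtDistance zero    A p (suc k) q≡ equal = det-adjacentEqualColumns k A λ r →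
    ≡.subst (λ i → A r i ≈ A r (suc k))
            (toℕ-injective (≡.trans (ℕ.suc-injective (≡.sym q≡)) (≡.sym (toℕ-inject₁ k)))) (equal r)
  det-equalColumnsAtDistance (suc d) A p (suc k) q≡ equal = begin
    det R _ A                                        ≈⟨ -‿involutive _ ⟨
    - - det R _ A                                    ≈⟨ -‿cong (det-swapAdjacentColumns k A) ⟨
    - det R _ (λ r c → A r (swapAdjacent k c))
      ≈⟨ -‿cong (det-equalColumnsAtDistance d _ p (inject₁ k) k≡ equal′) ⟩
    - 0#                                             ≈⟨ -0#≈0# ⟩
    0#                                               ∎
    where
    k≡ : toℕ (inject₁ k) ≡ suc (d ℕ.+ toℕ p)
    k≡ = ≡.trans (toℕ-inject₁ k) (ℕ.suc-injective q≡)
    p≢k : p ≢ inject₁ k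
    p≢k p≡k = ℕ.m≢1+n+m (toℕ p) (≡.trans (≡.cong toℕ p≡k) k≡)
    p≢k+1 : p ≢ suc k
    p≢k+1 p≡k+1 = ℕ.m≢1+n+m (toℕ p) (≡.trans (≡.cong toℕ p≡k+1) q≡)
    equal′ : ∀ r → A r (swapAdjacent k p) ≈ A r (swapAdjacent k (inject₁ k))
    equal′ r = begin
      A r (swapAdjacent k p)           ≡⟨ ≡.cong (A r) (swapAdjacent-fixes k p p≢k p≢k+1) ⟩
      A r p                            ≈⟨ equal r ⟩
      A r (suc k)                      ≡⟨ ≡.cong (A r) (swapAdjacent-inject₁ k) ⟨
      A r (swapAdjacent k (inject₁ k)) ∎

  det-equalColumns< : ∀ {n} (A : Matrix n) (p q : Fin n) → toℕ p ℕ.< toℕ q →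
    (∀ r → A r p ≈ A r q) → det R n A ≈ 0#
  det-equalColumns< A p q p<q = det-equalColumnsAtDistance (toℕ q ℕ.∸ suc (toℕ p)) A p q
    (≡.trans (≡.sym (ℕ.m∸n+n≡m p<q)) (ℕ.+-suc _ (toℕ p)))

  det-equalColumns : ∀ {n} (A : Matrix n) (p q : Fin n) → p ≢ q → (∀ r → A r p ≈ A r q) → det R n A ≈ 0#
  det-equalColumns A p q p≢q equal with ℕ.<-cmp (toℕ p) (toℕ q)
  ... | tri< p<q _ _ = det-equalColumns< A p q p<q equal
  ... | tri≈ _ p≡q _ = ⊥-elim (p≢q (toℕ-injective p≡q))
  ... | tri> _ _ q<p = det-equalColumns< A q p q<p (sym ∘ equal)

  det-equalRows : ∀ {n} (A : Matrix n) (p q : Fin n) → p ≢ q → (∀ c → A p c ≈ A q c) → det R n A ≈ 0#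
  det-equalRows A p q p≢q equal = trans (sym (det-transpose A)) (det-equalColumns (A ᵀ) p q p≢q equal)

  replaceRow : ∀ {n} → Matrix n → Fin n → (Fin n → Carrier) → Matrix n
  replaceRow A w v = updateAt A w (λ _ → v)

  replaceRow-at : ∀ {n} (A : Matrix n) w v c → replaceRow A w v w c ≡ v c
  replaceRow-at A w v c = ≡.cong-app (updateAt-updates w A) c

  replaceRow-other : ∀ {n} (A : Matrix n) w v r → r ≢ w → ∀ c → replaceRow A w v r c ≡ A r c
  replaceRow-other A w v r r≢w c = ≡.cong-app (updateAt-minimal r w A r≢w) c

  det-combineRows : ∀ {n K} (w : Fin n) (d : Carrier) (coef : Fin K → Carrier) (idx : Fin K → Fin n)
    (A B : Matrix n) → (∀ q → idx q ≢ w) → (∀ r → r ≢ w → ∀ c → B r c ≈ A r c) →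
    (∀ c → B w c ≈ d * A w c + ∑[ q < K ] (coef q * A (idx q) c)) → det R n B ≈ d * det R n A
  det-combineRows {n} {zero} w d coef idx A B _ B≈A Bw = begin
    det R n B                       ≈⟨ det-linearRow w d B A zeroed B≈A B≈zeroed Bw′ ⟩
    d * det R n A + det R n zeroed  ≈⟨ +-congˡ (det-zeroRow w zeroed (reflexive ∘ replaceRow-at A w _)) ⟩
    d * det R n A + 0#              ≈⟨ +-identityʳ _ ⟩
    d * det R n A                   ∎
    where
    zeroed : Matrix n
    zeroed = replaceRow A w (λ _ → 0#)
    B≈zeroed : ∀ r → r ≢ w → ∀ c → B r c ≈ zeroed r c
    B≈zeroed r r≢w c = trans (B≈A r r≢w c) (reflexive (≡.sym (replaceRow-other A w _ r r≢w c)))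
    Bw′ : ∀ c → B w c ≈ d * A w c + zeroed w c
    Bw′ c = trans (Bw c) (+-congˡ (reflexive (≡.sym (replaceRow-at A w _ c))))
  det-combineRows {n} {suc K} w d coef idx A B idx≢w B≈A Bw = begin
    det R n B                                  ≈⟨ det-linearRow w (coef zero) B copied rest B≈copied B≈rest Bw′ ⟩
    coef zero * det R n copied + det R n rest  ≈⟨ +-cong (*-congˡ copied≈0) restLemma ⟩
    coef zero * 0# + d * det R n A             ≈⟨ +-congʳ (zeroʳ _) ⟩
    0# + d * det R n A                         ≈⟨ +-identityˡ _ ⟩
    d * det R n A                              ∎
    where
    rowRest : Fin n → Carrier
    rowRest c = d * A w c + ∑[ q < K ] (coef (suc q) * A (idx (suc q)) c)
    copied rest : Matrix n
    copied = replaceRow B w (A (idx zero))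
    rest = replaceRow B w rowRest
    B≈copied : ∀ r → r ≢ w → ∀ c → B r c ≈ copied r c
    B≈copied r r≢w c = reflexive (≡.sym (replaceRow-other B w _ r r≢w c))
    B≈rest : ∀ r → r ≢ w → ∀ c → B r c ≈ rest r c
    B≈rest r r≢w c = reflexive (≡.sym (replaceRow-other B w _ r r≢w c))
    Bw′ : ∀ c → B w c ≈ coef zero * copied w c + rest w c
    Bw′ c = begin
      B w c                                                  ≈⟨ Bw c ⟩
      d * A w c + (coef zero * A (idx zero) c + _)           ≈⟨ x+yz≈y+xz _ _ _ ⟩
      coef zero * A (idx zero) c + rowRest c                 ≡⟨ ≡.cong₂ (λ u v → coef zero * u + v)
                                                                  (replaceRow-at B w _ c) (replaceRow-at B w _ c) ⟨
      coef zero * copied w c + rest w c                      ∎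
    copied≈0 : det R n copied ≈ 0#
    copied≈0 = det-equalRows copied w (idx zero) (idx≢w zero ∘ ≡.sym) λ c → begin
      copied w c            ≡⟨ replaceRow-at B w _ c ⟩
      A (idx zero) c        ≈⟨ B≈A (idx zero) (idx≢w zero) c ⟨
      B (idx zero) c        ≡⟨ replaceRow-other B w _ (idx zero) (idx≢w zero) c ⟨
      copied (idx zero) c   ∎
    restLemma : det R n rest ≈ d * det R n A
    restLemma = det-combineRows w d (coef ∘ suc) (idx ∘ suc) A rest (idx≢w ∘ suc)
      (λ r r≢w c → trans (reflexive (replaceRow-other B w _ r r≢w c)) (B≈A r r≢w c))
      (reflexive ∘ replaceRow-at B w rowRest)

  det-firstRowUnit : ∀ {n} (A : Matrix (suc n)) → A zero zero ≈ 1# → (∀ j → A zero (suc j) ≈ 0#) →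
    det R (suc n) A ≈ det R n (minor A zero zero)
  det-firstRowUnit {n} A A₀₀≈1 A₀ⱼ≈0 = begin
    det R (suc n) A                                                    ≈⟨ det-expandFirstRow A ⟩
    1# * A zero zero * det R n (minor A zero zero) + ∑[ j < n ] expansionTerm A (suc j)
      ≈⟨ +-cong (*-congʳ (trans (*-identityˡ _) A₀₀≈1))
                (∑-zero λ j → trans (*-congʳ (*-congˡ (A₀ⱼ≈0 j))) (trans (*-congʳ (zeroʳ _)) (zeroˡ _))) ⟩
    1# * det R n (minor A zero zero) + 0#                              ≈⟨ +-identityʳ _ ⟩
    1# * det R n (minor A zero zero)                                   ≈⟨ *-identityˡ _ ⟩
    det R n (minor A zero zero)                                        ∎

  -- Row operations on ℕ-indexed families of rows

  Row : Set c
  Row = ℕ → Carrier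

  zeroRow : Row
  zeroRow _ = 0#

  leading : (M : ℕ) → (ℕ → Row) → Matrix M
  leading M A r c = A (toℕ r) (toℕ c)

  append-cong : ∀ k {h h′ rest rest′ : ℕ → Row} →
    (∀ i j → h i j ≈ h′ i j) → (∀ t j → rest t j ≈ rest′ t j) →
    ∀ t j → append k h rest t j ≈ append k h′ rest′ t j
  append-cong zero    h≈h′ rest≈rest′ t       = rest≈rest′ t
  append-cong (suc k) h≈h′ rest≈rest′ zero    = h≈h′ zero
  append-cong (suc k) h≈h′ rest≈rest′ (suc t) = append-cong k (h≈h′ ∘ suc) rest≈rest′ t

  stackRows-cong : ∀ n α {h h′ : Fin n → ℕ → Row} {z z′ : Row} →
    (∀ b i j → h b i j ≈ h′ b i j) → (∀ j → z j ≈ z′ j) →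
    ∀ t j → stackRows n α h z t j ≈ stackRows n α h′ z′ t j
  stackRows-cong zero    α h≈h′ z≈z′ t = z≈z′
  stackRows-cong (suc n) α h≈h′ z≈z′   =
    append-cong (α zero) (h≈h′ zero) (stackRows-cong n (α ∘ suc) (h≈h′ ∘ suc) z≈z′)

  prodBelow : (ℕ → Carrier) → ℕ → Carrier
  prodBelow d zero    = 1#
  prodBelow d (suc k) = d zero * prodBelow (d ∘ suc) k

  prodBelow-snoc : ∀ d k → prodBelow d (suc k) ≈ prodBelow d k * d k
  prodBelow-snoc d zero    = trans (*-identityʳ _) (sym (*-identityˡ _))
  prodBelow-snoc d (suc k) = trans (*-congˡ (prodBelow-snoc (d ∘ suc) k)) (sym (*-assoc _ _ _))

  prodBelow-≈1 : ∀ {d} k → (∀ t → d t ≈ 1#) → prodBelow d k ≈ 1#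
  prodBelow-≈1 zero    d≈1 = refl
  prodBelow-≈1 (suc k) d≈1 = trans (*-cong (d≈1 zero) (prodBelow-≈1 k (d≈1 ∘ suc))) (*-identityˡ 1#)

  prodBelow-append : ∀ k (h rest : ℕ → Carrier) m →
    prodBelow (append k h rest) (k ℕ.+ m) ≈ prodBelow h k * prodBelow rest m
  prodBelow-append zero    h rest m = sym (*-identityˡ _)
  prodBelow-append (suc k) h rest m =
    trans (*-congˡ (prodBelow-append k (h ∘ suc) rest m)) (sym (*-assoc _ _ _))

  prodBelow-const : ∀ y k → prodBelow (λ _ → y) k ≈ pow R y k
  prodBelow-const y zero    = refl
  prodBelow-const y (suc k) = trans (*-congˡ (prodBelow-const y k)) (*-comm _ _)

  prodBelow-stackRows : ∀ n α (e : Fin n → Carrier) →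
    prodBelow (stackRows n α (λ b _ → e b) 1#) (sumℕ n α) ≈ prodFin R n (λ b → pow R (e b) (α b))
  prodBelow-stackRows zero    α e = refl
  prodBelow-stackRows (suc n) α e = trans (prodBelow-append (α zero) _ _ _)
    (*-cong (prodBelow-const (e zero) (α zero)) (prodBelow-stackRows n (α ∘ suc) (e ∘ suc)))

  det-splice-suc : ∀ M (A B : ℕ → Row) (d : ℕ → Carrier) (L : (t : ℕ) → Fin t → Carrier) →
    (∀ t j → B t j ≈ d t * A t j + ∑[ q < t ] (L t q * A (toℕ q) j)) →
    ∀ k → k ℕ.< M → det R M (leading M (splice k A B)) ≈ d k * det R M (leading M (splice (suc k) A B))
  det-splice-suc M A B d L B≈ k k<M = det-combineRows w (d k) (L k) idx _ _ idx≢w unchanged combined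
    where
    w : Fin M
    w = Fin.fromℕ< k<M
    idx : Fin k → Fin M
    idx q = Fin.inject≤ q (ℕ.<⇒≤ k<M)
    idx≢w : ∀ q → idx q ≢ w
    idx≢w q idx≡w = ℕ.<⇒≢ (toℕ<n q)
      (≡.trans (≡.sym (toℕ-inject≤ q _)) (≡.trans (≡.cong toℕ idx≡w) (toℕ-fromℕ< k<M)))
    unchanged : ∀ r → r ≢ w → ∀ c → leading M (splice k A B) r c ≈ leading M (splice (suc k) A B) r c
    unchanged r r≢w c with ℕ.<-cmp (toℕ r) k
    ... | tri< r<k _ _ = reflexive (≡.cong-app (≡.trans (splice-< k A B _ r<k)
                           (≡.sym (splice-< (suc k) A B _ (ℕ.m<n⇒m<1+n r<k)))) (toℕ c))
    ... | tri≈ _ r≡k _ = ⊥-elim (r≢w (toℕ-injective (≡.trans r≡k (≡.sym (toℕ-fromℕ< k<M)))))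
    ... | tri> _ _ k<r = reflexive (≡.cong-app (≡.trans (splice-≥ k A B _ (ℕ.<⇒≤ k<r))
                           (≡.sym (splice-≥ (suc k) A B _ k<r))) (toℕ c))
    combined : ∀ c → leading M (splice k A B) w c ≈
      d k * leading M (splice (suc k) A B) w c + ∑[ q < k ] (L k q * leading M (splice (suc k) A B) (idx q) c)
    combined c = begin
      splice k A B (toℕ w) (toℕ c)          ≡⟨ ≡.cong (λ t → splice k A B t (toℕ c)) (toℕ-fromℕ< k<M) ⟩
      splice k A B k (toℕ c)                ≡⟨ ≡.cong-app (splice-≥ k A B k ℕ.≤-refl) (toℕ c) ⟩
      B k (toℕ c)                           ≈⟨ B≈ k (toℕ c) ⟩
      d k * A k (toℕ c) + ∑[ q < k ] (L k q * A (toℕ q) (toℕ c))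
        ≈⟨ +-cong (*-congˡ (reflexive (processedRow (toℕ w) (toℕ-fromℕ< k<M) ℕ.≤-refl)))
                  (sum-cong-≋ λ q → *-congˡ (reflexive
                     (processedRow (toℕ (idx q)) (toℕ-inject≤ q _) (ℕ.<⇒≤ (toℕ<n q))))) ⟨
      d k * leading M (splice (suc k) A B) w c + ∑[ q < k ] (L k q * leading M (splice (suc k) A B) (idx q) c) ∎
      where
      processedRow : ∀ t {u} → t ≡ u → u ℕ.≤ k → splice (suc k) A B t (toℕ c) ≡ A u (toℕ c)
      processedRow t ≡.refl t≤k = ≡.cong-app (splice-< (suc k) A B t (ℕ.s≤s t≤k)) (toℕ c)

  det-lowerTriangular : ∀ M (A B : ℕ → Row) (d : ℕ → Carrier) (L : (t : ℕ) → Fin t → Carrier) →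
    (∀ t j → B t j ≈ d t * A t j + ∑[ q < t ] (L t q * A (toℕ q) j)) →
    det R M (leading M B) ≈ prodBelow d M * det R M (leading M A)
  det-lowerTriangular M A B d L B≈ = begin
    det R M (leading M B)                              ≈⟨ processed M ℕ.≤-refl ⟩
    prodBelow d M * det R M (leading M (splice M A B))
      ≈⟨ *-congˡ (det-cong λ r c → reflexive (≡.cong-app (splice-< M A B (toℕ r) (toℕ<n r)) (toℕ c))) ⟩
    prodBelow d M * det R M (leading M A)              ∎
    where
    processed : ∀ k → k ℕ.≤ M → det R M (leading M B) ≈ prodBelow d k * det R M (leading M (splice k A B))
    processed zero    _   = sym (*-identityˡ _)
    processed (suc k) k<M = begin
      det R M (leading M B)                                             ≈⟨ processed k (ℕ.<⇒≤ k<M) ⟩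
      prodBelow d k * det R M (leading M (splice k A B))                ≈⟨ *-congˡ (det-splice-suc M A B d L B≈ k k<M) ⟩
      prodBelow d k * (d k * det R M (leading M (splice (suc k) A B)))  ≈⟨ *-assoc _ _ _ ⟨
      prodBelow d k * d k * det R M (leading M (splice (suc k) A B))    ≈⟨ *-congʳ (prodBelow-snoc d k) ⟨
      prodBelow d (suc k) * det R M (leading M (splice (suc k) A B))    ∎

  -- B = L·A for the lower bidiagonal L with diagonal d and subdiagonal s; p stands for the row
  -- above row 0, so that a block can be handled inside a larger stack.
  Bidiagonal : Row → (d s : ℕ → Carrier) → (A B : ℕ → Row) → Set ℓ
  Bidiagonal p d s A B = ∀ t j → B t j ≈ d t * A t j + s t * cons p A t j

  onlyLast : ∀ {t} → Carrier → Fin t → Carrier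
  onlyLast {suc zero}    s zero    = s
  onlyLast {suc (suc t)} s zero    = 0#
  onlyLast {suc (suc t)} s (suc q) = onlyLast s q

  ∑-onlyLast : ∀ t s (h : ℕ → Carrier) → ∑[ q < suc t ] (onlyLast s q * h (toℕ q)) ≈ s * h t
  ∑-onlyLast zero    s h = +-identityʳ _
  ∑-onlyLast (suc t) s h = trans (+-congʳ (zeroˡ _)) (trans (+-identityˡ _) (∑-onlyLast t s (h ∘ suc)))

  det-lowerBidiagonal : ∀ M (A B : ℕ → Row) (d s : ℕ → Carrier) → Bidiagonal zeroRow d s A B →
    det R M (leading M B) ≈ prodBelow d M * det R M (leading M A)
  det-lowerBidiagonal M A B d s bidiagonal =
    det-lowerTriangular M A B d (λ t → onlyLast (s t)) triangular
    where
    triangular : ∀ t j → B t j ≈ d t * A t j + ∑[ q < t ] (onlyLast (s t) q * A (toℕ q) j)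
    triangular zero    j = trans (bidiagonal zero j) (+-congˡ (zeroʳ _))
    triangular (suc t) j = trans (bidiagonal (suc t) j) (+-congˡ (sym (∑-onlyLast t (s (suc t)) (λ l → A l j))))

  Bidiagonal-append : ∀ k {p} {dh sh dr sr : ℕ → Carrier} {h hB rest restB : ℕ → Row} →
    Bidiagonal p dh sh h hB → (∀ p′ → Bidiagonal p′ dr sr rest restB) →
    Bidiagonal p (append k dh dr) (append k sh sr) (append k h rest) (append k hB restB)
  Bidiagonal-append zero    hyp restHyp = restHyp _
  Bidiagonal-append (suc k) {p} {dh} {sh} {dr} {sr} {h} {hB} {rest} {restB} hyp restHyp = λ where
      zero          j → hyp zero j
      (suc zero)    j → tailLemma zero j
      (suc (suc t)) j → tailLemma (suc t) j
    where
    tailHyp : Bidiagonal (h zero) (dh ∘ suc) (sh ∘ suc) (h ∘ suc) (hB ∘ suc)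
    tailHyp zero    = hyp (suc zero)
    tailHyp (suc t) = hyp (suc (suc t))
    tailLemma : Bidiagonal (h zero) (append k (dh ∘ suc) dr) (append k (sh ∘ suc) sr)
                  (append k (h ∘ suc) rest) (append k (hB ∘ suc) restB)
    tailLemma = Bidiagonal-append k tailHyp restHyp

  Bidiagonal-stackRows : ∀ n α {d s : Fin n → ℕ → Carrier} {h hB : Fin n → ℕ → Row}
    {d₀ s₀ : Carrier} {z zB : Row} → (∀ b p → Bidiagonal p (d b) (s b) (h b) (hB b)) →
    (∀ p → Bidiagonal p (λ _ → d₀) (λ _ → s₀) (λ _ → z) (λ _ → zB)) →
    ∀ p → Bidiagonal p (stackRows n α d d₀) (stackRows n α s s₀) (stackRows n α h z) (stackRows n α hB zB)
  Bidiagonal-stackRows zero    α blockHyp defaultHyp p = defaultHyp p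
  Bidiagonal-stackRows (suc n) α blockHyp defaultHyp p =
    Bidiagonal-append (α zero) (blockHyp zero p) (Bidiagonal-stackRows n (α ∘ suc) (blockHyp ∘ suc) defaultHyp)

  -- Power series

  sumUpTo-cong : ∀ k {h h′ : ℕ → Carrier} → (∀ l → l ℕ.≤ k → h l ≈ h′ l) →
    sumUpTo R h k ≈ sumUpTo R h′ k
  sumUpTo-cong zero    h≈h′ = h≈h′ 0 ℕ.z≤n
  sumUpTo-cong (suc k) h≈h′ =
    +-cong (sumUpTo-cong k λ l l≤k → h≈h′ l (ℕ.m≤n⇒m≤1+n l≤k)) (h≈h′ (suc k) ℕ.≤-refl)

  sumUpTo-zero : ∀ k {h : ℕ → Carrier} → (∀ l → h l ≈ 0#) → sumUpTo R h k ≈ 0#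
  sumUpTo-zero zero    h≈0 = h≈0 0
  sumUpTo-zero (suc k) h≈0 = trans (+-cong (sumUpTo-zero k h≈0) (h≈0 (suc k))) (+-identityˡ 0#)

  sumUpTo-suc : ∀ k (h : ℕ → Carrier) → sumUpTo R h (suc k) ≈ h 0 + sumUpTo R (h ∘ suc) k
  sumUpTo-suc zero    h = refl
  sumUpTo-suc (suc k) h = trans (+-congʳ (sumUpTo-suc k h)) (+-assoc _ _ _)

  sumUpTo-reverse : ∀ k (h : ℕ → Carrier) → sumUpTo R h k ≈ sumUpTo R (λ l → h (k ℕ.∸ l)) k
  sumUpTo-reverse zero    h = refl
  sumUpTo-reverse (suc k) h = begin
    sumUpTo R h k + h (suc k)                           ≈⟨ +-congʳ (sumUpTo-reverse k h) ⟩
    sumUpTo R (λ l → h (k ℕ.∸ l)) k + h (suc k)         ≈⟨ +-comm _ _ ⟩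
    h (suc k) + sumUpTo R (λ l → h (k ℕ.∸ l)) k         ≈⟨ sumUpTo-suc k (λ l → h (suc k ℕ.∸ l)) ⟨
    sumUpTo R (λ l → h (suc k ℕ.∸ l)) (suc k)           ∎

  sumUpTo-truncate : ∀ k e {h : ℕ → Carrier} → (∀ l → k ℕ.< l → l ℕ.≤ e ℕ.+ k → h l ≈ 0#) →
    sumUpTo R h (e ℕ.+ k) ≈ sumUpTo R h k
  sumUpTo-truncate k zero    h≈0 = refl
  sumUpTo-truncate k (suc e) h≈0 = trans (+-congˡ (h≈0 _ (ℕ.s≤s (ℕ.m≤n+m k e)) ℕ.≤-refl))
    (trans (+-identityʳ _) (sumUpTo-truncate k e λ l k<l l≤e+k → h≈0 l k<l (ℕ.m≤n⇒m≤1+n l≤e+k)))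

  *-distribˡ-sumUpTo : ∀ k a (h : ℕ → Carrier) → a * sumUpTo R h k ≈ sumUpTo R (λ l → a * h l) k
  *-distribˡ-sumUpTo zero    a h = refl
  *-distribˡ-sumUpTo (suc k) a h = trans (distribˡ a _ _) (+-congʳ (*-distribˡ-sumUpTo k a h))

  sumUpTo≈∑ : ∀ k (h : ℕ → Carrier) → sumUpTo R h k ≈ ∑[ q < suc k ] h (toℕ q)
  sumUpTo≈∑ zero    h = sym (+-identityʳ _)
  sumUpTo≈∑ (suc k) h = trans (sumUpTo-suc k h) (+-congˡ (sumUpTo≈∑ k (h ∘ suc)))

  mulS-comm : ∀ (a b : ℕ → Carrier) k → mulS R a b k ≈ mulS R b a k
  mulS-comm a b k = trans (sumUpTo-reverse k _) (sumUpTo-cong k λ l l≤k →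
    trans (*-comm _ _) (*-congʳ (reflexive (≡.cong b (ℕ.m∸[m∸n]≡n l≤k)))))

  mulS-last : ∀ (a g : ℕ → Carrier) k →
    mulS R a g k ≈ g 0 * a k + ∑[ q < k ] (g (k ℕ.∸ toℕ q) * a (toℕ q))
  mulS-last a g k = begin
    mulS R a g k                                             ≈⟨ sumUpTo≈∑ k (λ l → a l * g (k ℕ.∸ l)) ⟩
    ∑[ q < suc k ] term (toℕ q)                              ≈⟨ sum-init-last (term ∘ toℕ) ⟩
    ∑[ q < k ] term (toℕ (inject₁ q)) + term (toℕ (Fin.fromℕ k))
      ≈⟨ +-cong (sum-cong-≋ {k} λ q → trans (reflexive (≡.cong term (toℕ-inject₁ q))) (*-comm _ _))
                (reflexive (≡.trans (≡.cong term (toℕ-fromℕ k)) (≡.cong (λ l → a k * g l) (ℕ.n∸n≡0 k)))) ⟩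
    ∑[ q < k ] (g (k ℕ.∸ toℕ q) * a (toℕ q)) + a k * g 0     ≈⟨ trans (+-comm _ _) (+-congʳ (*-comm _ _)) ⟩
    g 0 * a k + ∑[ q < k ] (g (k ℕ.∸ toℕ q) * a (toℕ q))    ∎
    where
    term : ℕ → Carrier
    term l = a l * g (k ℕ.∸ l)

  mulS-geomS-suc : ∀ y (P : ℕ → Carrier) k →
    mulS R P (geomS R y) (suc k) ≈ y * mulS R P (geomS R y) k + P (suc k)
  mulS-geomS-suc y P k = +-cong (begin
    sumUpTo R (λ l → P l * pow R y (suc k ℕ.∸ l)) k
      ≈⟨ sumUpTo-cong k (λ l l≤k → *-congˡ (reflexive (≡.cong (pow R y) (ℕ.+-∸-assoc 1 l≤k)))) ⟩
    sumUpTo R (λ l → P l * (pow R y (k ℕ.∸ l) * y)) k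
      ≈⟨ sumUpTo-cong k (λ l _ → trans (sym (*-assoc _ _ _)) (*-comm _ _)) ⟩
    sumUpTo R (λ l → y * (P l * pow R y (k ℕ.∸ l))) k        ≈⟨ *-distribˡ-sumUpTo k y _ ⟨
    y * mulS R P (geomS R y) k                               ∎)
    (trans (*-congˡ (reflexive (≡.cong (pow R y) (ℕ.n∸n≡0 k)))) (*-identityʳ _))

  det-mulSeriesRows : ∀ M (A : ℕ → Row) (g : ℕ → Carrier) → g 0 ≈ 1# →
    det R M (leading M (λ t → mulS R (A t) g)) ≈ det R M (leading M A)
  det-mulSeriesRows M A g g₀≈1 = begin
    det R M (leading M (λ t → mulS R (A t) g))        ≈⟨ det-transpose (leading M (λ j t → mulS R (A t) g j)) ⟩
    det R M (leading M (λ j t → mulS R (A t) g j))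
      ≈⟨ det-lowerTriangular M (λ j t → A t j) _ (λ _ → g 0) (λ j q → g (j ℕ.∸ toℕ q))
                             (λ j t → mulS-last (A t) g j) ⟩
    prodBelow (λ _ → g 0) M * det R M (leading M (λ j t → A t j))
      ≈⟨ *-cong (prodBelow-≈1 M (λ _ → g₀≈1)) (det-transpose (leading M A)) ⟩
    1# * det R M (leading M A)                        ≈⟨ *-identityˡ _ ⟩
    det R M (leading M A)                             ∎

  -- The confluent Vandermonde rows

  -- geomRow y i is the coefficient sequence of tⁱ/(1 − y t)^(i+1); the recursion is
  -- (1 − y t)·geomRow y (i+1) = t·geomRow y i read off coefficientwise.
  geomRow : Carrier → ℕ → Row
  geomRow y zero    zero    = 1#
  geomRow y zero    (suc j) = y * geomRow y zero j
  geomRow y (suc i) zero    = 0#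
  geomRow y (suc i) (suc j) = y * geomRow y (suc i) j + geomRow y i j

  geomRow-below : ∀ y i j → j ℕ.< i → geomRow y i j ≈ 0#
  geomRow-below y (suc i) zero    _           = refl
  geomRow-below y (suc i) (suc j) (ℕ.s≤s j<i) = trans
    (+-cong (trans (*-congˡ (geomRow-below y (suc i) j (ℕ.m<n⇒m<1+n j<i))) (zeroʳ y)) (geomRow-below y i j j<i))
    (+-identityˡ 0#)

  powS-geomS : ∀ y i k → powS R (geomS R y) (suc i) k ≈ geomRow y i (k ℕ.+ i)
  powS-geomS y zero    zero    = *-identityʳ _
  powS-geomS y zero    (suc k) =
    trans (mulS-geomS-suc y (oneS R) k) (trans (+-identityʳ _) (*-congˡ (powS-geomS y zero k)))
  powS-geomS y (suc i) zero    = begin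
    powS R (geomS R y) (suc i) zero * 1#          ≈⟨ *-identityʳ _ ⟩
    powS R (geomS R y) (suc i) zero               ≈⟨ powS-geomS y i zero ⟩
    geomRow y i i                                 ≈⟨ +-identityˡ _ ⟨
    0# + geomRow y i i
      ≈⟨ +-congʳ (trans (*-congˡ (geomRow-below y (suc i) i (ℕ.n<1+n i))) (zeroʳ y)) ⟨
    y * geomRow y (suc i) i + geomRow y i i       ∎
  powS-geomS y (suc i) (suc k) = begin
    powS R (geomS R y) (suc (suc i)) (suc k)
      ≈⟨ mulS-geomS-suc y (powS R (geomS R y) (suc i)) k ⟩
    y * powS R (geomS R y) (suc (suc i)) k + powS R (geomS R y) (suc i) (suc k)
      ≈⟨ +-cong (*-congˡ (powS-geomS y (suc i) k)) (powS-geomS y i (suc k)) ⟩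
    y * geomRow y (suc i) (k ℕ.+ suc i) + geomRow y i (suc k ℕ.+ i)
      ≡⟨ ≡.cong (λ l → y * geomRow y (suc i) (k ℕ.+ suc i) + geomRow y i l) (ℕ.+-suc k i) ⟨
    y * geomRow y (suc i) (k ℕ.+ suc i) + geomRow y i (k ℕ.+ suc i) ∎

  entryM≈mulS : ∀ (f : ℕ → Carrier) y i j → entryM R f y i j ≈ mulS R (geomRow y i) f j
  entryM≈mulS f y i j with i ℕ.≤? j
  ... | yes i≤j = begin
    sumUpTo R (λ l → f l * powS R (geomS R y) (suc i) (k ℕ.∸ l)) k
      ≈⟨ sumUpTo-cong k (λ l l≤k → *-congˡ (trans (powS-geomS y i (k ℕ.∸ l))
           (reflexive (≡.cong (geomRow y i) (≡.trans (≡.sym (ℕ.+-∸-comm i l≤k)) (≡.cong (ℕ._∸ l) k+i≡j)))))) ⟩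
    sumUpTo R (λ l → f l * geomRow y i (j ℕ.∸ l)) k
      ≈⟨ sumUpTo-truncate k i (λ l k<l l≤i+k →
           trans (*-congˡ (geomRow-below y i (j ℕ.∸ l) (below l k<l l≤i+k))) (zeroʳ _)) ⟨
    sumUpTo R (λ l → f l * geomRow y i (j ℕ.∸ l)) (i ℕ.+ k)
      ≡⟨ ≡.cong (sumUpTo R (λ l → f l * geomRow y i (j ℕ.∸ l))) (ℕ.m+[n∸m]≡n i≤j) ⟩
    mulS R f (geomRow y i) j                        ≈⟨ mulS-comm f (geomRow y i) j ⟩
    mulS R (geomRow y i) f j                        ∎
    where
    k : ℕ
    k = j ℕ.∸ i
    k+i≡j : k ℕ.+ i ≡ j
    k+i≡j = ℕ.m∸n+n≡m i≤j
    below : ∀ l → k ℕ.< l → l ℕ.≤ i ℕ.+ k → j ℕ.∸ l ℕ.< i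
    below l k<l l≤i+k = ≡.subst (j ℕ.∸ l ℕ.<_) (ℕ.m∸[m∸n]≡n i≤j)
      (ℕ.∸-monoʳ-< k<l (≡.subst (l ℕ.≤_) (ℕ.m+[n∸m]≡n i≤j) l≤i+k))
  ... | no  i≰j = sym (trans (mulS-comm (geomRow y i) f j) (sumUpTo-zero j λ l →
    trans (*-congˡ (geomRow-below y i (j ℕ.∸ l) (ℕ.≤-<-trans (ℕ.m∸n≤m j l) (ℕ.≰⇒> i≰j)))) (zeroʳ _)))

  oneMinus : Carrier → ℕ → Carrier
  oneMinus x zero          = 1#
  oneMinus x (suc zero)    = - x
  oneMinus x (suc (suc _)) = 0#

  mulS-oneMinus-suc : ∀ x (a : Row) j → mulS R a (oneMinus x) (suc j) ≈ a (suc j) + - x * a j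
  mulS-oneMinus-suc x a j = begin
    mulS R a (oneMinus x) (suc j)                               ≈⟨ mulS-comm a (oneMinus x) (suc j) ⟩
    mulS R (oneMinus x) a (suc j)                               ≈⟨ sumUpTo-suc j _ ⟩
    1# * a (suc j) + sumUpTo R (λ l → oneMinus x (suc l) * a (j ℕ.∸ l)) j
      ≈⟨ +-cong (*-identityˡ _) (onlySecond j) ⟩
    a (suc j) + - x * a j                                       ∎
    where
    onlySecond : ∀ j → sumUpTo R (λ l → oneMinus x (suc l) * a (j ℕ.∸ l)) j ≈ - x * a j
    onlySecond zero    = refl
    onlySecond (suc j) = trans (sumUpTo-suc j _) (trans (+-congˡ (sumUpTo-zero j λ _ → zeroˡ _)) (+-identityʳ _))

  shiftedProduct : Carrier → Row → Row
  shiftedProduct x₀ u j = mulS R u (oneMinus x₀) (suc j)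

  Bidiagonal-shiftedProduct-node : ∀ x₀ p →
    Bidiagonal p (λ _ → 1#) (λ _ → 0#) (geomRow x₀) (λ i → shiftedProduct x₀ (geomRow x₀ (suc i)))
  Bidiagonal-shiftedProduct-node x₀ p i j = begin
    shiftedProduct x₀ (geomRow x₀ (suc i)) j                          ≈⟨ mulS-oneMinus-suc x₀ _ j ⟩
    x₀ * geomRow x₀ (suc i) j + geomRow x₀ i j + - x₀ * geomRow x₀ (suc i) j ≈⟨ [xe+d]+[-x]e≈d x₀ _ _ ⟩
    geomRow x₀ i j                                                    ≈⟨ 1a+0b≈a _ _ ⟨
    1# * geomRow x₀ i j + 0# * cons p (geomRow x₀) i j                ∎

  Bidiagonal-shiftedProduct-otherNode : ∀ x₀ y p →
    Bidiagonal p (λ _ → y - x₀) (cons 0# (λ _ → 1#)) (geomRow y) (λ i → shiftedProduct x₀ (geomRow y i))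
  Bidiagonal-shiftedProduct-otherNode x₀ y p zero j = begin
    shiftedProduct x₀ (geomRow y zero) j                      ≈⟨ mulS-oneMinus-suc x₀ _ j ⟩
    y * geomRow y zero j + - x₀ * geomRow y zero j            ≈⟨ +-congʳ (+-identityʳ _) ⟨
    y * geomRow y zero j + 0# + - x₀ * geomRow y zero j       ≈⟨ [ye+d]+[-x]e≈[y-x]e+d x₀ y _ 0# ⟩
    (y - x₀) * geomRow y zero j + 0#                          ≈⟨ +-congˡ (zeroˡ (p j)) ⟨
    (y - x₀) * geomRow y zero j + 0# * p j                    ∎
  Bidiagonal-shiftedProduct-otherNode x₀ y p (suc i) j = begin
    shiftedProduct x₀ (geomRow y (suc i)) j                   ≈⟨ mulS-oneMinus-suc x₀ _ j ⟩
    y * geomRow y (suc i) j + geomRow y i j + - x₀ * geomRow y (suc i) j ≈⟨ [ye+d]+[-x]e≈[y-x]e+d x₀ y _ _ ⟩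
    (y - x₀) * geomRow y (suc i) j + geomRow y i j            ≈⟨ +-congˡ (*-identityˡ _) ⟨
    (y - x₀) * geomRow y (suc i) j + 1# * geomRow y i j       ∎

  Bidiagonal-shiftedProduct-zeroRow : ∀ x₀ p →
    Bidiagonal p (λ _ → 1#) (λ _ → 0#) (λ _ → zeroRow) (λ _ → shiftedProduct x₀ zeroRow)
  Bidiagonal-shiftedProduct-zeroRow x₀ p t j =
    trans (sumUpTo-zero (suc j) λ _ → zeroˡ _) (sym (1a+0b≈a 0# (cons p (λ _ → zeroRow) t j)))

  prodFin-cong : ∀ n {f g : Fin n → Carrier} → (∀ i → f i ≈ g i) → prodFin R n f ≈ prodFin R n g
  prodFin-cong zero    f≈g = refl
  prodFin-cong (suc n) f≈g = *-cong (f≈g zero) (prodFin-cong n (f≈g ∘ suc))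

  prodFin-≈1 : ∀ n {f : Fin n → Carrier} → (∀ i → f i ≈ 1#) → prodFin R n f ≈ 1#
  prodFin-≈1 zero    f≈1 = refl
  prodFin-≈1 (suc n) f≈1 = trans (*-cong (f≈1 zero) (prodFin-≈1 n (f≈1 ∘ suc))) (*-identityˡ 1#)

  prodFin-* : ∀ n (f g : Fin n → Carrier) → prodFin R n (λ i → f i * g i) ≈ prodFin R n f * prodFin R n g
  prodFin-* zero    f g = sym (*-identityˡ 1#)
  prodFin-* (suc n) f g = trans (*-congˡ (prodFin-* n (f ∘ suc) (g ∘ suc))) (interchange _ _ _ _)

  pow-+ : ∀ y m k → pow R y (m ℕ.+ k) ≈ pow R y m * pow R y k
  pow-+ y zero    k = sym (*-identityˡ _)
  pow-+ y (suc m) k = trans (*-congʳ (pow-+ y m k)) (xy∙z≈xz∙y _ _ _)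

  -- Names the factor function local to the definition of vandProd.
  vandFactors : ∀ n (α : Fin n → ℕ) (x : Fin n → Carrier) →
    Σ[ F ∈ (Fin n → Fin n → Carrier) ] vandProd R n α x ≡ prodFin R n (λ j → prodFin R n (λ i → F i j))
  vandFactors n α x = _ , ≡.refl

  vandFactor : ∀ n → (Fin n → ℕ) → (Fin n → Carrier) → Fin n → Fin n → Carrier
  vandFactor n α x = proj₁ (vandFactors n α x)

  vandFactor-suc : ∀ n α x i j → vandFactor (suc n) α x (suc i) (suc j) ≡ vandFactor n (α ∘ suc) (x ∘ suc) i j
  vandFactor-suc n α x i j with T? (toℕ i ℕ.<ᵇ toℕ j)
  ... | yes _ = ≡.refl
  ... | no  _ = ≡.refl

  vandProd-suc : ∀ n α x → vandProd R (suc n) α x ≈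
    prodFin R n (λ b → pow R (x (suc b) - x zero) (α zero ℕ.* α (suc b))) * vandProd R n (α ∘ suc) (x ∘ suc)
  vandProd-suc n α x = begin
    vandProd R (suc n) α x
      ≈⟨ *-cong (trans (*-identityˡ _) (prodFin-≈1 n λ _ → refl))
                (prodFin-cong n λ j → *-congˡ (prodFin-cong n λ i → reflexive (vandFactor-suc n α x i j))) ⟩
    1# * prodFin R n (λ j → pow R (x (suc j) - x zero) (α zero ℕ.* α (suc j)) *
                            prodFin R n (λ i → vandFactor n (α ∘ suc) (x ∘ suc) i j))
      ≈⟨ trans (*-identityˡ _) (prodFin-* n _ _) ⟩
    prodFin R n (λ b → pow R (x (suc b) - x zero) (α zero ℕ.* α (suc b))) * vandProd R n (α ∘ suc) (x ∘ suc) ∎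

  det-eliminateGeomRow : ∀ N x₀ (H : ℕ → Row) →
    det R (suc N) (leading (suc N) (cons (geomRow x₀ zero) H)) ≈ det R N (leading N (shiftedProduct x₀ ∘ H))
  det-eliminateGeomRow N x₀ H = begin
    det R (suc N) (leading (suc N) F)              ≈⟨ det-mulSeriesRows (suc N) F (oneMinus x₀) refl ⟨
    det R (suc N) (leading (suc N) F′)             ≈⟨ det-firstRowUnit (leading (suc N) F′) (*-identityʳ 1#) unitRow ⟩
    det R N (leading N (shiftedProduct x₀ ∘ H))    ∎
    where
    F F′ : ℕ → Row
    F = cons (geomRow x₀ zero) H
    F′ t = mulS R (F t) (oneMinus x₀)
    unitRow : ∀ j → shiftedProduct x₀ (geomRow x₀ zero) (toℕ j) ≈ 0#
    unitRow j = trans (mulS-oneMinus-suc x₀ (geomRow x₀ zero) (toℕ j))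
                      (trans (+-congˡ ([-x]y≈-xy x₀ _)) (-‿inverseʳ _))

  det-confluentRows : ∀ n α x →
    det R (sumℕ n α) (leading (sumℕ n α) (stackRows n α (geomRow ∘ x) zeroRow)) ≈ vandProd R n α x

  det-confluentRows-withBlock : ∀ a x₀ n α x →
    det R (a ℕ.+ sumℕ n α)
      (leading (a ℕ.+ sumℕ n α) (append a (geomRow x₀) (stackRows n α (geomRow ∘ x) zeroRow)))
      ≈ prodFin R n (λ b → pow R (x b - x₀) (a ℕ.* α b)) * vandProd R n α x

  det-confluentRows zero    α x = refl
  det-confluentRows (suc n) α x =
    trans (det-confluentRows-withBlock (α zero) (x zero) n (α ∘ suc) (x ∘ suc)) (sym (vandProd-suc n α x))

  det-confluentRows-withBlock zero    x₀ n α x =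
    trans (det-confluentRows n α x) (sym (trans (*-congʳ (prodFin-≈1 n λ _ → refl)) (*-identityˡ _)))
  det-confluentRows-withBlock (suc a) x₀ n α x = begin
    det R (suc N) (leading (suc N) (append (suc a) (geomRow x₀) rest))
      ≈⟨ det-cong headTail ⟩
    det R (suc N) (leading (suc N) (cons (geomRow x₀ zero) (append a (geomRow x₀ ∘ suc) rest)))
      ≈⟨ det-eliminateGeomRow N x₀ (append a (geomRow x₀ ∘ suc) rest) ⟩
    det R N (leading N (λ t → shiftedProduct x₀ (append a (geomRow x₀ ∘ suc) rest t)))
      ≈⟨ det-cong {N} (λ r c → reflexive (≡.cong-app (eliminated (toℕ r)) (toℕ c))) ⟩
    det R N (leading N B)                         ≈⟨ det-lowerBidiagonal N A B d s bidiagonal ⟩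
    prodBelow d N * det R N (leading N A)         ≈⟨ *-cong diagonal (det-confluentRows-withBlock a x₀ n α x) ⟩
    powers α * (powers (λ b → a ℕ.* α b) * vandProd R n α x)
      ≈⟨ *-assoc _ _ _ ⟨
    powers α * powers (λ b → a ℕ.* α b) * vandProd R n α x
      ≈⟨ *-congʳ (trans (prodFin-cong n λ b → pow-+ (x b - x₀) (α b) (a ℕ.* α b)) (prodFin-* n _ _)) ⟨
    powers (λ b → suc a ℕ.* α b) * vandProd R n α x ∎
    where
    N : ℕ
    N = a ℕ.+ sumℕ n α
    powers : (Fin n → ℕ) → Carrier
    powers e = prodFin R n (λ b → pow R (x b - x₀) (e b))
    rest A B : ℕ → Row
    rest = stackRows n α (geomRow ∘ x) zeroRow
    A = append a (geomRow x₀) rest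
    B = append a (λ i → shiftedProduct x₀ (geomRow x₀ (suc i)))
          (stackRows n α (λ b i → shiftedProduct x₀ (geomRow (x b) i)) (shiftedProduct x₀ zeroRow))
    headTail : ∀ r c → leading (suc N) (append (suc a) (geomRow x₀) rest) r c ≈
                       leading (suc N) (cons (geomRow x₀ zero) (append a (geomRow x₀ ∘ suc) rest)) r c
    headTail zero    c = refl
    headTail (suc r) c = refl
    d s : ℕ → Carrier
    d = append a (λ _ → 1#) (stackRows n α (λ b _ → x b - x₀) 1#)
    s = append a (λ _ → 0#) (stackRows n α (λ b → cons 0# (λ _ → 1#)) 0#)
    eliminated : ∀ t → shiftedProduct x₀ (append a (geomRow x₀ ∘ suc) rest t) ≡ B t
    eliminated t = ≡.trans (append-map (shiftedProduct x₀) a (geomRow x₀ ∘ suc) rest t)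
      (append-congʳ a _ (stackRows-map (shiftedProduct x₀) n α (geomRow ∘ x) zeroRow) t)
    bidiagonal : Bidiagonal zeroRow d s A B
    bidiagonal = Bidiagonal-append a (Bidiagonal-shiftedProduct-node x₀ zeroRow)
      (Bidiagonal-stackRows n α (λ b → Bidiagonal-shiftedProduct-otherNode x₀ (x b))
                                (Bidiagonal-shiftedProduct-zeroRow x₀))
    diagonal : prodBelow d N ≈ powers α
    diagonal = begin
      prodBelow d N                                  ≈⟨ prodBelow-append a _ _ (sumℕ n α) ⟩
      prodBelow (λ _ → 1#) a * prodBelow (stackRows n α (λ b _ → x b - x₀) 1#) (sumℕ n α)
        ≈⟨ *-cong (prodBelow-≈1 a λ _ → refl) (prodBelow-stackRows n α (λ b → x b - x₀)) ⟩
      1# * powers α                                  ≈⟨ *-identityˡ _ ⟩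
      powers α                                       ∎

  det-blockMatrix : ∀ (f : ℕ → Carrier) → f 0 ≈ 1# → ∀ n α x →
    det R (sumℕ n α) (blockMatrix R f n α x) ≈ vandProd R n α x
  det-blockMatrix f f₀≈1 n α x = begin
    det R m (blockMatrix R f n α x)
      ≈⟨ det-cong {m} (λ r c → reflexive (≡.cong-app (rows r) c)) ⟩
    det R m (leading m (stackRows n α (λ b i → entryM R f (x b) i) zeroRow))
      ≈⟨ det-cong {m} (λ r c → stackRows-cong n α (λ b → entryM≈mulS f (x b))
                                 (λ j → sym (sumUpTo-zero j λ _ → zeroˡ _)) (toℕ r) (toℕ c)) ⟩
    det R m (leading m (stackRows n α (λ b i → mulS R (geomRow (x b) i) f) (mulS R zeroRow f)))
      ≈⟨ det-cong {m} (λ r c → reflexive (≡.cong-app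
           (stackRows-map (λ u → mulS R u f) n α (geomRow ∘ x) zeroRow (toℕ r)) (toℕ c))) ⟨
    det R m (leading m (λ t → mulS R (stackRows n α (geomRow ∘ x) zeroRow t) f))
      ≈⟨ det-mulSeriesRows m (stackRows n α (geomRow ∘ x) zeroRow) f f₀≈1 ⟩
    det R m (leading m (stackRows n α (geomRow ∘ x) zeroRow))            ≈⟨ det-confluentRows n α x ⟩
    vandProd R n α x                                                     ∎
    where
    m : ℕ
    m = sumℕ n α
    atColumns : Row → Fin m → Carrier
    atColumns u c = u (toℕ c)
    rows : ∀ r → blockMatrix R f n α x r ≡ leading m (stackRows n α (λ b i → entryM R f (x b) i) zeroRow) r
    rows r = ≡.trans
      (lookup-stack n α (λ b → Mblock R f (α b) m (x b)) (λ b i → atColumns (entryM R f (x b) i)) (atColumns zeroRow)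
         (λ b i → lookup∘tabulate (λ i c → entryM R f (x b) (toℕ i) (toℕ c)) i) r)
      (≡.sym (stackRows-map atColumns n α (λ b i → entryM R f (x b) i) zeroRow (toℕ r)))

theoremA1 : ∀ {c ℓ} (R : CommutativeRing c ℓ) (f : ℕ → CommutativeRing.Carrier R) →
            CommutativeRing._≈_ R (f 0) (CommutativeRing.1# R) →
            (n : ℕ) (α : Fin n → ℕ) → (∀ b → 1 ≤ α b) →
            (x : Fin n → CommutativeRing.Carrier R) →
            CommutativeRing._≈_ R
              (det R (sumℕ n α) (blockMatrix R f n α x))
              (vandProd R n α x)
theoremA1 R f f₀≈1 n α _ x = det-blockMatrix R f f₀≈1 n α x
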